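{- Let $R,C$ be positive integers, ${\cal I}=\{(i,j)\mid 1\le i\le R,\ 1\le j\le C\}$, and let $S$ be a nonempty proper subset of ${\cal I}$ that is a triangular set. Let $X\ne Y$ be tables in the same fiber and $Z=X-Y$. Suppose that for row classes $k\ne k'$ and column classes $l\ne l'$ the four blocks ${\cal I}_{kl},{\cal I}_{kl'},{\cal I}_{k'l},{\cal I}_{k'l'}$ satisfy one of: (i) ${\cal I}_{kl}>0$, ${\cal I}_{kl'}<0$, ${\cal I}_{k'l}<0$; (ii) ${\cal I}_{kl'}<0$, ${\cal I}_{k'l}<0$, ${\cal I}_{k'l'}>0$; (iii) ${\cal I}_{kl}<0$, ${\cal I}_{kl'}>0$, ${\cal I}_{k'l}>0$; (iv) ${\cal I}_{kl'}>0$, ${\cal I}_{k'l}>0$, ${\cal I}_{k'l'}<0$ (the remaining block in each case having arbitrary sign). If there exist $i,i',j,j'$ with $(i,j)\in{\cal I}_{kl}$, $(i',j)\in{\cal I}_{k'l}$, $(i,j')\in{\cal I}_{kl'}$, $(i',j')\in{\cal I}_{k'l'}$ and $B(i,i';j,j')\in{\cal B}_0(S)$, then $\Vert X-Y\Vert_1$ can be reduced by ${\cal B}_0(S)$.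
   Context: With ${\cal J}(i)=\{j\mid (i,j)\in S\}$, $S$ is triangular if for all rows $i,i'$, ${\cal J}(i)\subseteq{\cal J}(i')$ or ${\cal J}(i')\subseteq{\cal J}(i)$. Blocks: rows $i,i'$ are equivalent if ${\cal J}(i)={\cal J}(i')$, columns $j,j'$ are equivalent if $\{i\mid (i,j)\in S\}=\{i\mid (i,j')\in S\}$; ${\cal I}_{kl}$ is the set of cells with row in row class $k$ and column in column class $l$. For $Z=(z_{ij})$, ${\cal I}_{kl}>0$ means not all $z_{ij}$, $(i,j)\in{\cal I}_{kl}$, are zero and all nonzero ones are positive; ${\cal I}_{kl}<0$ analogously with negative. A table is an array on ${\cal I}$ with entries in $\mathbb{N}$; the fiber of $X$ is the set of tables with the same row sums, column sums and sum over $S$. For $i\ne i'$, $j\ne j'$, $B(i,i';j,j')$ has $+1$ at $(i,j),(i',j')$, $-1$ at $(i,j'),(i',j)$, $0$ elsewhere; ${\cal B}_0(S)$ is the set of such basic moves whose entries over $S$ sum to $0$. $\Vert W\Vert_1=\sum|w_{ij}|$. For $X\ne Y$ in the same fiber ${\cal F}$, $\Vert X-Y\Vert_1$ can be reduced by ${\cal B}_0(S)$ if there exist $\tau^+,\tau^-\ge0$, $\tau^++\tau^->0$, and $B^+_1,\dots,B^+_{\tau^+},B^-_1,\dots,B^-_{\tau^- }\in{\cal B}_0(S)$ with $X+\sum_{t=1}^{\tau'}B^+_t\in{\cal F}$ ($\tau'=1,\dots,\tau^+$), $Y-\sum_{t=1}^{\tau'}B^-_t\in{\cal F}$ ($\tau'=1,\dots,\tau^-$),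 and $\Vert X-Y+\sum_t B^+_t+\sum_t B^-_t\Vert_1<\Vert X-Y\Vert_1$. -}

module Defs where

open import Data.Nat as ℕ using (ℕ; zero; suc)
open import Data.Integer as ℤ using (ℤ; +_; 0ℤ; 1ℤ; -1ℤ; ∣_∣)
open import Data.Fin using (Fin; zero; suc)
open import Data.Bool using (Bool; true; false; if_then_else_)
open import Data.List using (List; []; _∷_; length; foldr)
open import Data.List.Relation.Unary.All using (All)
open import Data.Product using (Σ; ∃; ∃-syntax; _×_; _,_)
open import Data.Sum using (_⊎_)
open import Data.Unit using (⊤)
open import Relation.Binary.PropositionalEquality using (_≡_; _≢_)
open import Relation.Nullary using (¬_)
open import Relation.Nullary.Decidable using (⌊_⌋)
open import Data.Fin using (_≟_)

∑ : ∀ {n} → (Fin n → ℕ) → ℕ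
∑ {zero} f = 0
∑ {suc n} f = f zero ℕ.+ ∑ (λ k → f (suc k))

∑ℤ : ∀ {n} → (Fin n → ℤ) → ℤ
∑ℤ {zero} f = 0ℤ
∑ℤ {suc n} f = f zero ℤ.+ ∑ℤ (λ k → f (suc k))

Subset2 : ℕ → ℕ → Set
Subset2 R C = Fin R → Fin C → Bool

Table : ℕ → ℕ → Set
Table R C = Fin R → Fin C → ℕ

Mat : ℕ → ℕ → Set
Mat R C = Fin R → Fin C → ℤ

module _ {R C : ℕ} where

  RowIncl : Subset2 R C → Fin R → Fin R → Set
  RowIncl S i i' = ∀ j → S i j ≡ true → S i' j ≡ true

  Triangular : Subset2 R C → Set
  Triangular S = ∀ i i' → RowIncl S i i' ⊎ RowIncl S i' i

  Nonempty : Subset2 R C → Set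
  Nonempty S = ∃[ i ] ∃[ j ] S i j ≡ true

  Proper : Subset2 R C → Set
  Proper S = ∃[ i ] ∃[ j ] S i j ≡ false

  RowEquiv : Subset2 R C → Fin R → Fin R → Set
  RowEquiv S i i' = ∀ j → S i j ≡ S i' j

  ColEquiv : Subset2 R C → Fin C → Fin C → Set
  ColEquiv S j j' = ∀ i → S i j ≡ S i j'

  -- (i , j) ∈ I_kl, where the row class k is represented by the row r
  -- and the column class l by the column c
  InBlock : Subset2 R C → Fin R → Fin C → Fin R → Fin C → Set
  InBlock S r c i j = RowEquiv S i r × ColEquiv S j c

  BlockPos : Subset2 R C → Mat R C → Fin R → Fin C → Set
  BlockPos S Z r c =
    (∃[ i ] ∃[ j ] (InBlock S r c i j × Z i j ≢ 0ℤ)) ×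
    (∀ i j → InBlock S r c i j → Z i j ≢ 0ℤ → 0ℤ ℤ.< Z i j)

  BlockNeg : Subset2 R C → Mat R C → Fin R → Fin C → Set
  BlockNeg S Z r c =
    (∃[ i ] ∃[ j ] (InBlock S r c i j × Z i j ≢ 0ℤ)) ×
    (∀ i j → InBlock S r c i j → Z i j ≢ 0ℤ → Z i j ℤ.< 0ℤ)

  rowSum : Table R C → Fin R → ℕ
  rowSum X i = ∑ (λ j → X i j)

  colSum : Table R C → Fin C → ℕ
  colSum X j = ∑ (λ i → X i j)

  SSum : Subset2 R C → Table R C → ℕ
  SSum S X = ∑ (λ i → ∑ (λ j → if S i j then X i j else 0))

  SSumℤ : Subset2 R C → Mat R C → ℤ
  SSumℤ S W = ∑ℤ (λ i → ∑ℤ (λ j → if S i j then W i j else 0ℤ))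

  SameFiber : Subset2 R C → Table R C → Table R C → Set
  SameFiber S X Y =
    (∀ i → rowSum X i ≡ rowSum Y i) ×
    (∀ j → colSum X j ≡ colSum Y j) ×
    SSum S X ≡ SSum S Y

  toMat : Table R C → Mat R C
  toMat X i j = + (X i j)

  _⊕_ : Mat R C → Mat R C → Mat R C
  (A ⊕ B) i j = A i j ℤ.+ B i j

  _⊖_ : Mat R C → Mat R C → Mat R C
  (A ⊖ B) i j = A i j ℤ.- B i j

  zeroM : Mat R C
  zeroM i j = 0ℤ

  sumM : List (Mat R C) → Mat R C
  sumM = foldr _⊕_ zeroM

  norm1 : Mat R C → ℕ
  norm1 W = ∑ (λ i → ∑ (λ j → ∣ W i j ∣))

  basic : Fin R → Fin R → Fin C → Fin C → Mat R C
  basic i i' j j' a b =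
    if ⌊ a ≟ i ⌋ then (if ⌊ b ≟ j ⌋ then 1ℤ else if ⌊ b ≟ j' ⌋ then -1ℤ else 0ℤ)
    else if ⌊ a ≟ i' ⌋ then (if ⌊ b ≟ j' ⌋ then 1ℤ else if ⌊ b ≟ j ⌋ then -1ℤ else 0ℤ)
    else 0ℤ

  BasicInB0 : Subset2 R C → Fin R → Fin R → Fin C → Fin C → Set
  BasicInB0 S i i' j j' = i ≢ i' × j ≢ j' × SSumℤ S (basic i i' j j') ≡ 0ℤ

  IsB0 : Subset2 R C → Mat R C → Set
  IsB0 S W = ∃[ i ] ∃[ i' ] ∃[ j ] ∃[ j' ]
    (BasicInB0 S i i' j j' × (∀ a b → W a b ≡ basic i i' j j' a b))

  InFiber : Subset2 R C → Table R C → Mat R C → Set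
  InFiber S X W = ∃[ T ] (SameFiber S T X × (∀ i j → + (T i j) ≡ W i j))

  ValidPlus : Subset2 R C → Table R C → Mat R C → List (Mat R C) → Set
  ValidPlus S X W [] = ⊤
  ValidPlus S X W (B ∷ Bs) = InFiber S X (W ⊕ B) × ValidPlus S X (W ⊕ B) Bs

  ValidMinus : Subset2 R C → Table R C → Mat R C → List (Mat R C) → Set
  ValidMinus S X W [] = ⊤
  ValidMinus S X W (B ∷ Bs) = InFiber S X (W ⊖ B) × ValidMinus S X (W ⊖ B) Bs

  Reducible : Subset2 R C → Table R C → Table R C → Set
  Reducible S X Y = ∃[ Bp ] ∃[ Bm ]
    ( 0 ℕ.< length Bp ℕ.+ length Bm
    × All (IsB0 S) Bp × All (IsB0 S) Bm
    × ValidPlus S X (toMat X) Bp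
    × ValidMinus S X (toMat Y) Bm
    × norm1 (((toMat X ⊖ toMat Y) ⊕ sumM Bp) ⊕ sumM Bm) ℕ.< norm1 (toMat X ⊖ toMat Y))

-- Write Z = X − Y. The basic move B(p,q;r,s), subtracted from Y, adds 1 to Z at the
-- corners (p,r), (q,s) and −1 at (p,s), (q,r). When Z is negative at the +1 corners
-- the move stays in the fiber and does not increase ‖Z‖₁; it decreases ‖Z‖₁ if Z is
-- positive at a −1 corner, and otherwise it leaves Z negative at both −1 corners.
-- In case (i) take Z(a,b) > 0 in I_kl and Z(c,d), Z(e,f) < 0 in I_kl', I_k'l. The
-- S-sum of a basic move depends only on the blocks of its corners, so B(c,e;d,f) is
-- in B₀(S); unless it already reduces ‖Z‖₁ it makes Z(c,f) < 0, with (c,f) in the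
-- blocks of (a,b). A basic move whose two rows (or two columns) are S-equivalent is
-- always in B₀(S), and all line sums of Z vanish: a negative entry in row a, then one
-- in column b, give at most two more such moves, the last with a −1 corner at (a,b).
-- Cases (ii)–(iv) are case (i) after exchanging k ↔ k', l ↔ l', or X ↔ Y.
module Submission where

open import Defs
open import Data.Bool using (Bool; true; false; if_then_else_)
open import Data.Empty using (⊥-elim)
open import Data.Fin using (Fin; zero; suc)
open import Data.Fin.Properties using (_≟_; any?; suc-injective)
open import Data.Integer as ℤ using (ℤ; +_; 0ℤ; 1ℤ; -1ℤ; ∣_∣; -[1+_]; +[1+_])
import Data.Integer.Properties as ℤP
open import Data.Integer.Tactic.RingSolver using (solve-∀)
open import Data.List using ([]; _∷_; length; map)
open import Data.List.Properties using (length-map)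
open import Data.List.Relation.Unary.All using (All; []; _∷_)
open import Data.Nat as ℕ using (ℕ; zero; suc; _<_)
import Data.Nat.Properties as ℕP
open import Data.Product using (∃-syntax; _×_; _,_)
open import Data.Sum using (_⊎_; inj₁; inj₂)
open import Data.Unit using (tt)
open import Function using (_∘_)
open import Relation.Binary.PropositionalEquality
open import Relation.Nullary using (¬_; Dec; yes; no)
open import Relation.Nullary.Decidable using (⌊_⌋)

-- Sums over Fin

∑-cong : ∀ {n} {f g : Fin n → ℕ} → (∀ k → f k ≡ g k) → ∑ f ≡ ∑ g
∑-cong {zero}  _  = refl
∑-cong {suc n} eq = cong₂ ℕ._+_ (eq zero) (∑-cong (eq ∘ suc))

∑ℤ-cong : ∀ {n} {f g : Fin n → ℤ} → (∀ k → f k ≡ g k) → ∑ℤ f ≡ ∑ℤ g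
∑ℤ-cong {zero}  _  = refl
∑ℤ-cong {suc n} eq = cong₂ ℤ._+_ (eq zero) (∑ℤ-cong (eq ∘ suc))

∑ℤ-zero : ∀ {n} {f : Fin n → ℤ} → (∀ k → f k ≡ 0ℤ) → ∑ℤ f ≡ 0ℤ
∑ℤ-zero {zero}  _  = refl
∑ℤ-zero {suc n} eq = cong₂ ℤ._+_ (eq zero) (∑ℤ-zero (eq ∘ suc))

∑ℤ-one-point : ∀ {n} {f : Fin n → ℤ} r → (∀ k → k ≢ r → f k ≡ 0ℤ) → ∑ℤ f ≡ f r
∑ℤ-one-point {f = f} zero off =
  trans (cong (ℤ._+_ (f zero)) (∑ℤ-zero (λ k → off (suc k) λ ()))) (ℤP.+-identityʳ (f zero))
∑ℤ-one-point {f = f} (suc r) off =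
  trans (cong (ℤ._+ ∑ℤ (f ∘ suc)) (off zero λ ()))
        (trans (ℤP.+-identityˡ _)
               (∑ℤ-one-point r (λ k k≢r → off (suc k) (k≢r ∘ suc-injective))))

∑ℤ-two-point : ∀ {n} {f : Fin n → ℤ} {r s} → r ≢ s →
  (∀ k → k ≢ r → k ≢ s → f k ≡ 0ℤ) → ∑ℤ f ≡ f r ℤ.+ f s
∑ℤ-two-point {r = zero} {zero} r≢s _ = ⊥-elim (r≢s refl)
∑ℤ-two-point {f = f} {zero} {suc s} _ off =
  cong (ℤ._+_ (f zero)) (∑ℤ-one-point s (λ k k≢s → off (suc k) (λ ()) (k≢s ∘ suc-injective)))
∑ℤ-two-point {f = f} {suc r} {zero} _ off =
  trans (cong (ℤ._+_ (f zero)) (∑ℤ-one-point r (λ k k≢r → off (suc k) (k≢r ∘ suc-injective) (λ ()))))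
        (ℤP.+-comm (f zero) (f (suc r)))
∑ℤ-two-point {f = f} {suc r} {suc s} r≢s off =
  trans (cong (ℤ._+ ∑ℤ (f ∘ suc)) (off zero (λ ()) (λ ())))
        (trans (ℤP.+-identityˡ _)
          (∑ℤ-two-point (r≢s ∘ cong suc)
            (λ k k≢r k≢s → off (suc k) (k≢r ∘ suc-injective) (k≢s ∘ suc-injective))))

∑ℤ-distrib-- : ∀ {n} (f g : Fin n → ℤ) → ∑ℤ (λ k → f k ℤ.- g k) ≡ ∑ℤ f ℤ.- ∑ℤ g
∑ℤ-distrib-- {zero}  _ _ = refl
∑ℤ-distrib-- {suc n} f g =
  trans (cong (ℤ._+_ (f zero ℤ.- g zero)) (∑ℤ-distrib-- (f ∘ suc) (g ∘ suc)))
        (interchange (f zero) (g zero) (∑ℤ (f ∘ suc)) (∑ℤ (g ∘ suc)))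
  where
  interchange : ∀ a b c d → (a ℤ.- b) ℤ.+ (c ℤ.- d) ≡ (a ℤ.+ c) ℤ.- (b ℤ.+ d)
  interchange = solve-∀

∑-toℤ : ∀ {n} (f : Fin n → ℕ) → + ∑ f ≡ ∑ℤ (λ k → + f k)
∑-toℤ {zero}  _ = refl
∑-toℤ {suc n} f =
  trans (ℤP.pos-+ (f zero) (∑ (f ∘ suc))) (cong (ℤ._+_ (+ f zero)) (∑-toℤ (f ∘ suc)))

∑-shift : ∀ {n} {f f' : Fin n → ℕ} (g : Fin n → ℤ) →
  (∀ k → + f' k ≡ + f k ℤ.- g k) → + ∑ f' ≡ + ∑ f ℤ.- ∑ℤ g
∑-shift {f = f} {f'} g eq =
  trans (∑-toℤ f')
        (trans (∑ℤ-cong eq) (trans (∑ℤ-distrib-- _ g) (cong (ℤ._- ∑ℤ g) (sym (∑-toℤ f)))))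

∑ℤ-balance : ∀ {n} {f g : Fin n → ℕ} {w : Fin n → ℤ} → ∑ f ≡ ∑ g →
  (∀ k → + g k ≡ w k) → ∑ℤ (λ k → + f k ℤ.- w k) ≡ 0ℤ
∑ℤ-balance {f = f} {g} {w} eq g≡w = begin
  ∑ℤ (λ k → + f k ℤ.- w k)     ≡⟨ ∑ℤ-distrib-- (λ k → + f k) w ⟩
  ∑ℤ (λ k → + f k) ℤ.- ∑ℤ w    ≡⟨ cong (ℤ._- ∑ℤ w) ∑f≡∑w ⟩
  ∑ℤ w ℤ.- ∑ℤ w                ≡⟨ ℤP.+-inverseʳ (∑ℤ w) ⟩
  0ℤ                           ∎
  where
  open ≡-Reasoning
  ∑f≡∑w : ∑ℤ (λ k → + f k) ≡ ∑ℤ w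
  ∑f≡∑w = trans (sym (∑-toℤ f)) (trans (cong +_ eq) (trans (∑-toℤ g) (∑ℤ-cong g≡w)))

∑ℤ-nonneg : ∀ {n} {f : Fin n → ℤ} → (∀ k → 0ℤ ℤ.≤ f k) → 0ℤ ℤ.≤ ∑ℤ f
∑ℤ-nonneg {zero}  _      = ℤP.≤-refl
∑ℤ-nonneg {suc n} nonneg = ℤP.+-mono-≤ (nonneg zero) (∑ℤ-nonneg (nonneg ∘ suc))

∑ℤ-pos : ∀ {n} {f : Fin n → ℤ} → (∀ k → 0ℤ ℤ.≤ f k) → ∀ k → 0ℤ ℤ.< f k → 0ℤ ℤ.< ∑ℤ f
∑ℤ-pos nonneg zero    pos = ℤP.+-mono-<-≤ pos (∑ℤ-nonneg (nonneg ∘ suc))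
∑ℤ-pos nonneg (suc k) pos = ℤP.+-mono-≤-< (nonneg zero) (∑ℤ-pos (nonneg ∘ suc) k pos)

zero-sum-has-negative : ∀ {n} {f : Fin n → ℤ} → ∑ℤ f ≡ 0ℤ →
  ∀ k → 0ℤ ℤ.< f k → ∃[ x ] f x ℤ.< 0ℤ
zero-sum-has-negative {f = f} ∑f≡0 k pos with any? (λ x → f x ℤ.<? 0ℤ)
... | yes negative = negative
... | no  none     =
  ⊥-elim (ℤP.<-irrefl (sym ∑f≡0) (∑ℤ-pos (λ x → ℤP.≮⇒≥ (none ∘ (x ,_))) k pos))

decrement-nonneg : ∀ {x w} → + x ℤ.- w ℤ.< 0ℤ → 0ℤ ℤ.≤ w → 0ℤ ℤ.≤ w ℤ.- 1ℤ
decrement-nonneg {w = + zero}   (ℤ.+<+ ()) _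
decrement-nonneg {w = +[1+ _ ]} _          _ = ℤ.+≤+ ℕ.z≤n

minus-nonpos : ∀ {w v} → 0ℤ ℤ.≤ w → v ℤ.≤ 0ℤ → 0ℤ ℤ.≤ w ℤ.- v
minus-nonpos w≥0 v≤0 = ℤP.+-mono-≤ w≥0 (ℤP.neg-mono-≤ v≤0)

not-pos⇒pred<0 : ∀ {z} → ¬ 0ℤ ℤ.< z → z ℤ.+ -1ℤ ℤ.< 0ℤ
not-pos⇒pred<0 {+ zero}    _       = ℤ.-<+
not-pos⇒pred<0 {+[1+ n ]}  not-pos = ⊥-elim (not-pos (ℤ.+<+ (ℕ.s≤s ℕ.z≤n)))
not-pos⇒pred<0 { -[1+ n ]} _       = ℤ.-<+

diff≤0⇒≤ : ∀ {m n} → + m ℤ.- + n ℤ.≤ 0ℤ → m ℕ.≤ n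
diff≤0⇒≤ m-n≤0 = ℤP.drop‿+≤+ (ℤP.i-j≤0⇒i≤j m-n≤0)

diff<0⇒< : ∀ {m n} → + m ℤ.- + n ℤ.< 0ℤ → m ℕ.< n
diff<0⇒< {m} {n} m-n<0 =
  ℤP.drop‿+<+ (subst₂ ℤ._<_ (cancel (+ m) (+ n)) (ℤP.+-identityˡ (+ n)) (ℤP.+-monoˡ-< (+ n) m-n<0))
  where
  cancel : ∀ i j → (i ℤ.- j) ℤ.+ j ≡ i
  cancel = solve-∀

absChange : ℤ → ℤ → ℤ
absChange z d = + ∣ z ℤ.+ d ∣ ℤ.- + ∣ z ∣

absChange-zero : ∀ z → absChange z 0ℤ ≡ 0ℤ
absChange-zero z rewrite ℤP.+-identityʳ z = ℤP.+-inverseʳ (+ ∣ z ∣)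

absChange-≤ : ∀ z d → absChange z d ℤ.≤ + ∣ d ∣
absChange-≤ z d =
  ℤP.≤-trans (ℤP.+-monoˡ-≤ (ℤ.- + ∣ z ∣) (ℤ.+≤+ (ℤP.∣i+j∣≤∣i∣+∣j∣ z d)))
             (ℤP.≤-reflexive (cancel (+ ∣ z ∣) (+ ∣ d ∣)))
  where
  cancel : ∀ a b → (a ℤ.+ b) ℤ.- a ≡ b
  cancel = solve-∀

absChange-toward-zero : ∀ {z} → z ℤ.< 0ℤ → absChange z 1ℤ ≡ -1ℤ
absChange-toward-zero {z} z<0 =
  trans (cong₂ ℤ._-_ (nonpos-abs z+1≤0) (nonpos-abs (ℤP.<⇒≤ z<0))) (shrink z)
  where
  nonpos-abs : ∀ {i} → i ℤ.≤ 0ℤ → + ∣ i ∣ ≡ ℤ.- i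
  nonpos-abs {+ zero}    _ = refl
  nonpos-abs { -[1+ _ ]} _ = refl
  nonpos-abs {+[1+ _ ]}  (ℤ.+≤+ ())
  z+1≤0 : z ℤ.+ 1ℤ ℤ.≤ 0ℤ
  z+1≤0 = subst (ℤ._≤ 0ℤ) (ℤP.+-comm 1ℤ z) (ℤP.i<j⇒suc[i]≤j z<0)
  shrink : ∀ i → ℤ.- (i ℤ.+ 1ℤ) ℤ.- ℤ.- i ≡ -1ℤ
  shrink = solve-∀

absChange-from-positive : ∀ {z} → 0ℤ ℤ.< z → absChange z -1ℤ ≡ -1ℤ
absChange-from-positive {z} z>0 =
  trans (cong₂ ℤ._-_ (ℤP.0≤i⇒+∣i∣≡i z-1≥0) (ℤP.0≤i⇒+∣i∣≡i (ℤP.<⇒≤ z>0))) (shrink z)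
  where
  z-1≥0 : 0ℤ ℤ.≤ z ℤ.+ -1ℤ
  z-1≥0 = subst (0ℤ ℤ.≤_) (ℤP.+-comm -1ℤ z) (ℤP.i<j⇒i≤pred[j] z>0)
  shrink : ∀ i → (i ℤ.+ -1ℤ) ℤ.- i ≡ -1ℤ
  shrink = solve-∀

χ : Bool → ℤ
χ b = if b then 1ℤ else 0ℤ

-- Basic moves

module _ {R C : ℕ} where

  data OffRectangle (p q : Fin R) (r s : Fin C) : Fin R → Fin C → Set where
    off-rows : ∀ {a b} → a ≢ p → a ≢ q → OffRectangle p q r s a b
    off-cols : ∀ {a b} → b ≢ r → b ≢ s → OffRectangle p q r s a b

  basic-off : ∀ p q r s a b → OffRectangle p q r s a b → basic {R} {C} p q r s a b ≡ 0ℤ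
  basic-off p q r s a b off with a ≟ p | a ≟ q | b ≟ r | b ≟ s | off
  ... | yes refl | _        | _        | _        | off-rows a≢p _ = ⊥-elim (a≢p refl)
  ... | no _     | yes refl | _        | _        | off-rows _ a≢q = ⊥-elim (a≢q refl)
  ... | _        | _        | yes refl | _        | off-cols b≢r _ = ⊥-elim (b≢r refl)
  ... | _        | _        | no _     | yes refl | off-cols _ b≢s = ⊥-elim (b≢s refl)
  ... | no _     | no _     | _        | _        | _              = refl
  ... | yes refl | _        | no _     | no _     | off-cols _ _   = refl
  ... | no _     | yes refl | no _     | no _     | off-cols _ _   = refl

  basic-pr : ∀ p q r s → basic {R} {C} p q r s p r ≡ 1ℤ
  basic-pr p q r s with p ≟ p | r ≟ r
  ... | yes _  | yes _  = refl
  ... | no p≢p | _      = ⊥-elim (p≢p refl)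
  ... | _      | no r≢r = ⊥-elim (r≢r refl)

  basic-ps : ∀ p q r s → r ≢ s → basic {R} {C} p q r s p s ≡ -1ℤ
  basic-ps p q r s r≢s with p ≟ p | s ≟ r | s ≟ s
  ... | yes _  | no _     | yes _  = refl
  ... | no p≢p | _        | _      = ⊥-elim (p≢p refl)
  ... | _      | yes refl | _      = ⊥-elim (r≢s refl)
  ... | _      | _        | no s≢s = ⊥-elim (s≢s refl)

  basic-qr : ∀ p q r s → p ≢ q → r ≢ s → basic {R} {C} p q r s q r ≡ -1ℤ
  basic-qr p q r s p≢q r≢s with q ≟ p | q ≟ q | r ≟ s | r ≟ r
  ... | no _     | yes _  | no _     | yes _  = refl
  ... | yes refl | _      | _        | _      = ⊥-elim (p≢q refl)
  ... | _        | no q≢q | _        | _      = ⊥-elim (q≢q refl)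
  ... | _        | _      | yes refl | _      = ⊥-elim (r≢s refl)
  ... | _        | _      | _        | no r≢r = ⊥-elim (r≢r refl)

  basic-qs : ∀ p q r s → p ≢ q → basic {R} {C} p q r s q s ≡ 1ℤ
  basic-qs p q r s p≢q with q ≟ p | q ≟ q | s ≟ s
  ... | no _     | yes _  | yes _  = refl
  ... | yes refl | _      | _      = ⊥-elim (p≢q refl)
  ... | _        | no q≢q | _      = ⊥-elim (q≢q refl)
  ... | _        | _      | no s≢s = ⊥-elim (s≢s refl)

  basic-swapRows : ∀ p q r s → p ≢ q → r ≢ s → ∀ a b →
    ℤ.- basic {R} {C} p q r s a b ≡ basic q p r s a b
  basic-swapRows p q r s p≢q r≢s a b with a ≟ p | a ≟ q | b ≟ r | b ≟ s
  ... | yes refl | yes refl | _        | _        = ⊥-elim (p≢q refl)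
  ... | _        | _        | yes refl | yes refl = ⊥-elim (r≢s refl)
  ... | yes refl | no _     | yes refl | no _     = refl
  ... | yes refl | no _     | no _     | yes refl = refl
  ... | yes refl | no _     | no _     | no _     = refl
  ... | no _     | yes refl | yes refl | no _     = refl
  ... | no _     | yes refl | no _     | yes refl = refl
  ... | no _     | yes refl | no _     | no _     = refl
  ... | no _     | no _     | _        | _        = refl

  ∑∑-basic : ∀ p q r s (F : Fin R → Fin C → ℤ → ℤ) → (∀ a b → F a b 0ℤ ≡ 0ℤ) →
    p ≢ q → r ≢ s →
    ∑ℤ (λ a → ∑ℤ (λ b → F a b (basic p q r s a b))) ≡
      (F p r 1ℤ ℤ.+ F p s -1ℤ) ℤ.+ (F q r -1ℤ ℤ.+ F q s 1ℤ)
  ∑∑-basic p q r s F F0≡0 p≢q r≢s = begin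
    ∑ℤ (λ a → ∑ℤ (G a))                                     ≡⟨ ∑ℤ-two-point p≢q offRows ⟩
    ∑ℤ (G p) ℤ.+ ∑ℤ (G q)                                   ≡⟨ cong₂ ℤ._+_ (row p) (row q) ⟩
    (G p r ℤ.+ G p s) ℤ.+ (G q r ℤ.+ G q s)                 ≡⟨ cong₂ ℤ._+_ (cong₂ ℤ._+_ pr ps)
                                                                             (cong₂ ℤ._+_ qr qs) ⟩
    (F p r 1ℤ ℤ.+ F p s -1ℤ) ℤ.+ (F q r -1ℤ ℤ.+ F q s 1ℤ)   ∎
    where
    open ≡-Reasoning
    G : Fin R → Fin C → ℤ
    G a b = F a b (basic p q r s a b)
    vanish : ∀ a b → OffRectangle p q r s a b → G a b ≡ 0ℤ
    vanish a b off = trans (cong (F a b) (basic-off p q r s a b off)) (F0≡0 a b)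
    offRows : ∀ a → a ≢ p → a ≢ q → ∑ℤ (G a) ≡ 0ℤ
    offRows a a≢p a≢q = ∑ℤ-zero (λ b → vanish a b (off-rows a≢p a≢q))
    row : ∀ a → ∑ℤ (G a) ≡ G a r ℤ.+ G a s
    row a = ∑ℤ-two-point r≢s (λ b b≢r b≢s → vanish a b (off-cols b≢r b≢s))
    pr : G p r ≡ F p r 1ℤ
    pr = cong (F p r) (basic-pr p q r s)
    ps : G p s ≡ F p s -1ℤ
    ps = cong (F p s) (basic-ps p q r s r≢s)
    qr : G q r ≡ F q r -1ℤ
    qr = cong (F q r) (basic-qr p q r s p≢q r≢s)
    qs : G q s ≡ F q s 1ℤ
    qs = cong (F q s) (basic-qs p q r s p≢q)

  basic-rowSum : ∀ p q r s → p ≢ q → r ≢ s → ∀ a → ∑ℤ (basic {R} {C} p q r s a) ≡ 0ℤ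
  basic-rowSum p q r s p≢q r≢s a =
    trans (∑ℤ-two-point {f = basic p q r s a} r≢s
                        (λ b b≢r b≢s → basic-off p q r s a b (off-cols b≢r b≢s)))
          (cancels a (a ≟ p) (a ≟ q))
    where
    cancels : ∀ a → Dec (a ≡ p) → Dec (a ≡ q) → basic p q r s a r ℤ.+ basic p q r s a s ≡ 0ℤ
    cancels _ (yes refl) _          = cong₂ ℤ._+_ (basic-pr p q r s) (basic-ps p q r s r≢s)
    cancels _ (no _)     (yes refl) = cong₂ ℤ._+_ (basic-qr p q r s p≢q r≢s) (basic-qs p q r s p≢q)
    cancels a (no a≢p)   (no a≢q)   =
      cong₂ ℤ._+_ (basic-off p q r s a r (off-rows a≢p a≢q)) (basic-off p q r s a s (off-rows a≢p a≢q))

  basic-colSum : ∀ p q r s → p ≢ q → r ≢ s → ∀ b → ∑ℤ (λ a → basic {R} {C} p q r s a b) ≡ 0ℤ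
  basic-colSum p q r s p≢q r≢s b =
    trans (∑ℤ-two-point {f = λ a → basic p q r s a b} p≢q
                        (λ a a≢p a≢q → basic-off p q r s a b (off-rows a≢p a≢q)))
          (cancels b (b ≟ r) (b ≟ s))
    where
    cancels : ∀ b → Dec (b ≡ r) → Dec (b ≡ s) → basic p q r s p b ℤ.+ basic p q r s q b ≡ 0ℤ
    cancels _ (yes refl) _          = cong₂ ℤ._+_ (basic-pr p q r s) (basic-qr p q r s p≢q r≢s)
    cancels _ (no _)     (yes refl) = cong₂ ℤ._+_ (basic-ps p q r s r≢s) (basic-qs p q r s p≢q)
    cancels b (no b≢r)   (no b≢s)   =
      cong₂ ℤ._+_ (basic-off p q r s p b (off-cols b≢r b≢s)) (basic-off p q r s q b (off-cols b≢r b≢s))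

  signedCorners : Subset2 R C → Fin R → Fin R → Fin C → Fin C → ℤ
  signedCorners P p q r s = (χ (P p r) ℤ.+ χ (P q s)) ℤ.- (χ (P p s) ℤ.+ χ (P q r))

  basic-SSum : ∀ (P : Subset2 R C) p q r s → p ≢ q → r ≢ s →
    SSumℤ P (basic p q r s) ≡ signedCorners P p q r s
  basic-SSum P p q r s p≢q r≢s =
    trans (∑∑-basic p q r s (λ a b v → if P a b then v else 0ℤ) (λ a b → if-zero (P a b)) p≢q r≢s)
      (trans (cong₂ (λ u v → (χ (P p r) ℤ.+ u) ℤ.+ (v ℤ.+ χ (P q s))) (if-neg (P p s)) (if-neg (P q r)))
             (regroup (χ (P p r)) (χ (P p s)) (χ (P q r)) (χ (P q s))))
    where
    if-zero : ∀ c → (if c then 0ℤ else 0ℤ) ≡ 0ℤ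
    if-zero true  = refl
    if-zero false = refl
    if-neg : ∀ c → (if c then -1ℤ else 0ℤ) ≡ ℤ.- χ c
    if-neg true  = refl
    if-neg false = refl
    regroup : ∀ x y w z → (x ℤ.+ ℤ.- y) ℤ.+ (ℤ.- w ℤ.+ z) ≡ (x ℤ.+ z) ℤ.- (y ℤ.+ w)
    regroup = solve-∀

  signedCorners-swapRows : ∀ P p q r s → signedCorners P q p r s ≡ ℤ.- signedCorners P p q r s
  signedCorners-swapRows P p q r s = swap (χ (P p r)) (χ (P q s)) (χ (P p s)) (χ (P q r))
    where
    swap : ∀ a b c d → (d ℤ.+ c) ℤ.- (b ℤ.+ a) ≡ ℤ.- ((a ℤ.+ b) ℤ.- (c ℤ.+ d))
    swap = solve-∀

  signedCorners-swapCols : ∀ P p q r s → signedCorners P p q s r ≡ ℤ.- signedCorners P p q r s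
  signedCorners-swapCols P p q r s = swap (χ (P p r)) (χ (P q s)) (χ (P p s)) (χ (P q r))
    where
    swap : ∀ a b c d → (c ℤ.+ d) ℤ.- (a ℤ.+ b) ≡ ℤ.- ((a ℤ.+ b) ℤ.- (c ℤ.+ d))
    swap = solve-∀

  signedCorners-swapBoth : ∀ P p q r s → signedCorners P q p s r ≡ signedCorners P p q r s
  signedCorners-swapBoth P p q r s = swap (χ (P p r)) (χ (P q s)) (χ (P p s)) (χ (P q r))
    where
    swap : ∀ a b c d → (b ℤ.+ a) ℤ.- (d ℤ.+ c) ≡ (a ℤ.+ b) ℤ.- (c ℤ.+ d)
    swap = solve-∀

  signedCorners-rowEquiv : ∀ P {p q} r s → RowEquiv P p q → signedCorners P p q r s ≡ 0ℤ
  signedCorners-rowEquiv P {p} {q} r s p~q rewrite p~q r | p~q s = cancel (χ (P q r)) (χ (P q s))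
    where
    cancel : ∀ u v → (u ℤ.+ v) ℤ.- (v ℤ.+ u) ≡ 0ℤ
    cancel = solve-∀

  signedCorners-colEquiv : ∀ P p q {r s} → ColEquiv P r s → signedCorners P p q r s ≡ 0ℤ
  signedCorners-colEquiv P p q {s = s} r~s rewrite r~s p | r~s q =
    ℤP.+-inverseʳ (χ (P p s) ℤ.+ χ (P q s))

  signedCorners-cong : ∀ P {p p' q q' r r' s s'} → RowEquiv P p p' → RowEquiv P q q' →
    ColEquiv P r r' → ColEquiv P s s' → signedCorners P p q r s ≡ signedCorners P p' q' r' s'
  signedCorners-cong P p~p' q~q' r~r' s~s' =
    cong₂ ℤ._-_ (cong₂ ℤ._+_ (cong χ (cell p~p' r~r')) (cong χ (cell q~q' s~s')))
                (cong₂ ℤ._+_ (cong χ (cell p~p' s~s')) (cong χ (cell q~q' r~r')))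
    where
    cell : ∀ {i i' j j'} → RowEquiv P i i' → ColEquiv P j j' → P i j ≡ P i' j'
    cell {i' = i'} {j} i~i' j~j' = trans (i~i' j) (j~j' i')

  sameFiber-sym : ∀ {S : Subset2 R C} {T T'} → SameFiber S T T' → SameFiber S T' T
  sameFiber-sym (rows , cols , sums) = (λ i → sym (rows i)) , (λ j → sym (cols j)) , sym sums

  sameFiber-trans : ∀ {S : Subset2 R C} {T T' T''} →
    SameFiber S T T' → SameFiber S T' T'' → SameFiber S T T''
  sameFiber-trans (rows , cols , sums) (rows' , cols' , sums') =
    (λ i → trans (rows i) (rows' i)) , (λ j → trans (cols j) (cols' j)) , trans sums sums'

  sameFiber-shift : ∀ (S : Subset2 R C) {T T' X : Table R C} (B : Mat R C) →
    (∀ a b → + T' a b ≡ + T a b ℤ.- B a b) →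
    (∀ a → ∑ℤ (B a) ≡ 0ℤ) → (∀ b → ∑ℤ (λ a → B a b) ≡ 0ℤ) → SSumℤ S B ≡ 0ℤ →
    SameFiber S T X → SameFiber S T' X
  sameFiber-shift S {T} {T'} B shifted rowsB colsB sumB (rows , cols , sums) =
    (λ i → trans (unshift (∑-shift (B i) (shifted i)) (rowsB i)) (rows i)) ,
    (λ j → trans (unshift (∑-shift (λ a → B a j) (λ a → shifted a j)) (colsB j)) (cols j)) ,
    trans (unshift (∑-shift (λ a → ∑ℤ (λ b → if S a b then B a b else 0ℤ))
                            (λ a → ∑-shift _ (shifted-on-S a))) sumB) sums
    where
    unshift : ∀ {m n z} → + m ≡ + n ℤ.- z → z ≡ 0ℤ → m ≡ n
    unshift m≡n-z refl = ℤP.+-injective (trans m≡n-z (ℤP.+-identityʳ _))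
    shifted-on-S : ∀ a b → + (if S a b then T' a b else 0) ≡
      + (if S a b then T a b else 0) ℤ.- (if S a b then B a b else 0ℤ)
    shifted-on-S a b with S a b
    ... | true  = shifted a b
    ... | false = refl

  inFiber-move : ∀ (S : Subset2 R C) (X : Table R C) {W p q r s} → BasicInB0 S p q r s →
    (toMat X ⊖ W) p r ℤ.< 0ℤ → (toMat X ⊖ W) q s ℤ.< 0ℤ →
    InFiber S X W → InFiber S X (W ⊖ basic p q r s)
  inFiber-move S X {W} {p} {q} {r} {s} (p≢q , r≢s , sumB) pr<0 qs<0 (T , T~X , T≡W) =
    T' ,
    sameFiber-shift S B shifted (basic-rowSum p q r s p≢q r≢s) (basic-colSum p q r s p≢q r≢s) sumB T~X ,
    T'≡W-B
    where
    B : Mat R C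
    B = basic p q r s
    W≥0 : ∀ a b → 0ℤ ℤ.≤ W a b
    W≥0 a b = subst (0ℤ ℤ.≤_) (T≡W a b) (ℤ.+≤+ ℕ.z≤n)
    W-B≥0 : ∀ a b → 0ℤ ℤ.≤ W a b ℤ.- B a b
    W-B≥0 a b with a ≟ p | a ≟ q | b ≟ r | b ≟ s
    ... | yes refl | _        | yes refl | _        = decrement-nonneg pr<0 (W≥0 a b)
    ... | yes refl | _        | no _     | yes refl = minus-nonpos (W≥0 a b) ℤ.-≤+
    ... | yes refl | _        | no _     | no _     = minus-nonpos (W≥0 a b) ℤP.≤-refl
    ... | no _     | yes refl | _        | yes refl = decrement-nonneg qs<0 (W≥0 a b)
    ... | no _     | yes refl | yes refl | no _     = minus-nonpos (W≥0 a b) ℤ.-≤+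
    ... | no _     | yes refl | no _     | no _     = minus-nonpos (W≥0 a b) ℤP.≤-refl
    ... | no _     | no _     | _        | _        = minus-nonpos (W≥0 a b) ℤP.≤-refl
    T' : Table R C
    T' a b = ∣ W a b ℤ.- B a b ∣
    T'≡W-B : ∀ a b → + T' a b ≡ W a b ℤ.- B a b
    T'≡W-B a b = ℤP.0≤i⇒+∣i∣≡i (W-B≥0 a b)
    shifted : ∀ a b → + T' a b ≡ + T a b ℤ.- B a b
    shifted a b = trans (T'≡W-B a b) (cong (ℤ._- B a b) (sym (T≡W a b)))

  norm1-cong : ∀ (A B : Mat R C) → (∀ a b → ∣ A a b ∣ ≡ ∣ B a b ∣) → norm1 A ≡ norm1 B
  norm1-cong _ _ eq = ∑-cong (λ a → ∑-cong (eq a))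

  norm1-neg : ∀ (A B : Mat R C) → (∀ a b → A a b ≡ ℤ.- B a b) → norm1 A ≡ norm1 B
  norm1-neg A B A≡-B = norm1-cong A B (λ a b → trans (cong ∣_∣ (A≡-B a b)) (ℤP.∣-i∣≡∣i∣ (B a b)))

  norm1-⊕-[] : ∀ (M : Mat R C) → norm1 (M ⊕ sumM []) ≡ norm1 M
  norm1-⊕-[] M = norm1-cong (M ⊕ sumM []) M (λ a b → cong ∣_∣ (ℤP.+-identityʳ (M a b)))

  norm1-toℤ : ∀ (M : Mat R C) → + norm1 M ≡ ∑ℤ (λ a → ∑ℤ (λ b → + ∣ M a b ∣))
  norm1-toℤ M = trans (∑-toℤ (λ a → ∑ (λ b → ∣ M a b ∣))) (∑ℤ-cong (λ a → ∑-toℤ (λ b → ∣ M a b ∣)))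

  norm1-move : ∀ (Z : Mat R C) p q r s → p ≢ q → r ≢ s →
    + norm1 (Z ⊕ basic p q r s) ℤ.- + norm1 Z ≡
      (absChange (Z p r) 1ℤ ℤ.+ absChange (Z p s) -1ℤ) ℤ.+
      (absChange (Z q r) -1ℤ ℤ.+ absChange (Z q s) 1ℤ)
  norm1-move Z p q r s p≢q r≢s = begin
    + norm1 (Z ⊕ B) ℤ.- + norm1 Z
      ≡⟨ cong₂ ℤ._-_ (norm1-toℤ (Z ⊕ B)) (norm1-toℤ Z) ⟩
    ∑ℤ (λ a → ∑ℤ (∣Z+B∣ a)) ℤ.- ∑ℤ (λ a → ∑ℤ (∣Z∣ a))
      ≡⟨ sym (∑ℤ-distrib-- (λ a → ∑ℤ (∣Z+B∣ a)) (λ a → ∑ℤ (∣Z∣ a))) ⟩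
    ∑ℤ (λ a → ∑ℤ (∣Z+B∣ a) ℤ.- ∑ℤ (∣Z∣ a))
      ≡⟨ sym (∑ℤ-cong (λ a → ∑ℤ-distrib-- (∣Z+B∣ a) (∣Z∣ a))) ⟩
    ∑ℤ (λ a → ∑ℤ (λ b → absChange (Z a b) (B a b)))
      ≡⟨ ∑∑-basic p q r s (λ a b → absChange (Z a b)) (λ a b → absChange-zero (Z a b)) p≢q r≢s ⟩
    (absChange (Z p r) 1ℤ ℤ.+ absChange (Z p s) -1ℤ) ℤ.+
    (absChange (Z q r) -1ℤ ℤ.+ absChange (Z q s) 1ℤ)
      ∎
    where
    open ≡-Reasoning
    B : Mat R C
    B = basic p q r s
    ∣Z+B∣ ∣Z∣ : Fin R → Fin C → ℤ
    ∣Z+B∣ a b = + ∣ Z a b ℤ.+ B a b ∣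
    ∣Z∣ a b = + ∣ Z a b ∣

  norm1-move-bound : ∀ (Z : Mat R C) p q r s → p ≢ q → r ≢ s →
    Z p r ℤ.< 0ℤ → Z q s ℤ.< 0ℤ →
    ∀ {u v} → absChange (Z p s) -1ℤ ℤ.≤ u → absChange (Z q r) -1ℤ ℤ.≤ v →
    + norm1 (Z ⊕ basic p q r s) ℤ.- + norm1 Z ℤ.≤ (-1ℤ ℤ.+ u) ℤ.+ (v ℤ.+ -1ℤ)
  norm1-move-bound Z p q r s p≢q r≢s pr<0 qs<0 ps≤u qr≤v =
    subst (ℤ._≤ _) (sym (norm1-move Z p q r s p≢q r≢s))
      (ℤP.+-mono-≤ (ℤP.+-mono-≤ (ℤP.≤-reflexive (absChange-toward-zero pr<0)) ps≤u)
                   (ℤP.+-mono-≤ qr≤v (ℤP.≤-reflexive (absChange-toward-zero qs<0))))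

  norm1-move-≤ : ∀ (Z : Mat R C) p q r s → p ≢ q → r ≢ s →
    Z p r ℤ.< 0ℤ → Z q s ℤ.< 0ℤ → norm1 (Z ⊕ basic p q r s) ℕ.≤ norm1 Z
  norm1-move-≤ Z p q r s p≢q r≢s pr<0 qs<0 =
    diff≤0⇒≤ (norm1-move-bound Z p q r s p≢q r≢s pr<0 qs<0
                (absChange-≤ (Z p s) -1ℤ) (absChange-≤ (Z q r) -1ℤ))

  norm1-move-< : ∀ (Z : Mat R C) p q r s → p ≢ q → r ≢ s →
    Z p r ℤ.< 0ℤ → Z q s ℤ.< 0ℤ → 0ℤ ℤ.< Z p s ⊎ 0ℤ ℤ.< Z q r →
    norm1 (Z ⊕ basic p q r s) ℕ.< norm1 Z
  norm1-move-< Z p q r s p≢q r≢s pr<0 qs<0 (inj₁ ps>0) =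
    diff<0⇒< (ℤP.≤-<-trans (norm1-move-bound Z p q r s p≢q r≢s pr<0 qs<0
      (ℤP.≤-reflexive (absChange-from-positive ps>0)) (absChange-≤ (Z q r) -1ℤ)) ℤ.-<+)
  norm1-move-< Z p q r s p≢q r≢s pr<0 qs<0 (inj₂ qr>0) =
    diff<0⇒< (ℤP.≤-<-trans (norm1-move-bound Z p q r s p≢q r≢s pr<0 qs<0
      (absChange-≤ (Z p s) -1ℤ) (ℤP.≤-reflexive (absChange-from-positive qr>0))) ℤ.-<+)

-- Reducing ‖X − W‖₁ by moves subtracted from W

-- Reducible S X Y without plus-moves, generalised to any array W (standing for Y)
-- and any bound N on the final norm.
ReducibleFrom : ∀ {R C} → Subset2 R C → Table R C → Mat R C → ℕ → Set
ReducibleFrom S X W N =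
  ∃[ Bs ] (All (IsB0 S) Bs × ValidMinus S X W Bs × norm1 ((toMat X ⊖ W) ⊕ sumM Bs) < N)

module _ {R C : ℕ} (S : Subset2 R C) (X : Table R C) where

  reducibleFrom-here : ∀ {W N} → norm1 (toMat X ⊖ W) < N → ReducibleFrom S X W N
  reducibleFrom-here {W} {N} lt = [] , [] , tt , subst (_< N) (sym (norm1-⊕-[] (toMat X ⊖ W))) lt

  reducibleFrom-cons : ∀ {W N B} → IsB0 S B → InFiber S X (W ⊖ B) →
    ReducibleFrom S X (W ⊖ B) N → ReducibleFrom S X W N
  reducibleFrom-cons {W} {N} {B} B∈B₀ inF (Bs , Bs∈B₀ , valid , lt) =
    B ∷ Bs , B∈B₀ ∷ Bs∈B₀ , (inF , valid) ,
    subst (_< N) (norm1-cong ((toMat X ⊖ (W ⊖ B)) ⊕ sumM Bs) ((toMat X ⊖ W) ⊕ sumM (B ∷ Bs))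
                   (λ a b → cong ∣_∣ (regroup (+ X a b) (W a b) (B a b) (sumM Bs a b)))) lt
    where
    regroup : ∀ x w b t → (x ℤ.- (w ℤ.- b)) ℤ.+ t ≡ (x ℤ.- w) ℤ.+ (b ℤ.+ t)
    regroup = solve-∀

  entry-after-move : ∀ W B a b → (toMat X ⊖ (W ⊖ B)) a b ≡ (toMat X ⊖ W) a b ℤ.+ B a b
  entry-after-move W B a b = shift (+ X a b) (W a b) (B a b)
    where
    shift : ∀ x w b → x ℤ.- (w ℤ.- b) ≡ (x ℤ.- w) ℤ.+ b
    shift = solve-∀

  entry-after-move-off : ∀ W p q r s a b → OffRectangle p q r s a b →
    (toMat X ⊖ (W ⊖ basic p q r s)) a b ≡ (toMat X ⊖ W) a b
  entry-after-move-off W p q r s a b off =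
    trans (entry-after-move W (basic p q r s) a b)
          (trans (cong (ℤ._+_ ((toMat X ⊖ W) a b)) (basic-off p q r s a b off)) (ℤP.+-identityʳ _))

  entry-after-move-lowered : ∀ W p q r s a b → basic p q r s a b ≡ -1ℤ →
    ¬ 0ℤ ℤ.< (toMat X ⊖ W) a b → (toMat X ⊖ (W ⊖ basic p q r s)) a b ℤ.< 0ℤ
  entry-after-move-lowered W p q r s a b B≡-1 ab≯0 =
    subst (ℤ._< 0ℤ)
      (sym (trans (entry-after-move W (basic p q r s) a b) (cong (ℤ._+_ ((toMat X ⊖ W) a b)) B≡-1)))
      (not-pos⇒pred<0 ab≯0)

  rowSum-zero : ∀ {W} → InFiber S X W → ∀ a → ∑ℤ (λ b → (toMat X ⊖ W) a b) ≡ 0ℤ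
  rowSum-zero (T , (rows , _ , _) , T≡W) a = ∑ℤ-balance (sym (rows a)) (T≡W a)

  colSum-zero : ∀ {W} → InFiber S X W → ∀ b → ∑ℤ (λ a → (toMat X ⊖ W) a b) ≡ 0ℤ
  colSum-zero (T , (_ , cols , _) , T≡W) b = ∑ℤ-balance (sym (cols b)) (λ a → T≡W a b)

  -- Either the move already brings the norm below N, or it keeps the norm at most N
  -- and makes X − W negative at both −1 corners, and the continuation takes over.
  reduce-by-move : ∀ {W N p q r s} → InFiber S X W → norm1 (toMat X ⊖ W) ℕ.≤ N →
    BasicInB0 S p q r s → (toMat X ⊖ W) p r ℤ.< 0ℤ → (toMat X ⊖ W) q s ℤ.< 0ℤ →
    (InFiber S X (W ⊖ basic p q r s) → norm1 (toMat X ⊖ (W ⊖ basic p q r s)) ℕ.≤ N →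
      ¬ 0ℤ ℤ.< (toMat X ⊖ W) p s → ¬ 0ℤ ℤ.< (toMat X ⊖ W) q r →
      ReducibleFrom S X (W ⊖ basic p q r s) N) →
    ReducibleFrom S X W N
  reduce-by-move {W} {N} {p} {q} {r} {s} inF ≤N B∈B₀@(p≢q , r≢s , _) pr<0 qs<0 continue =
    reducibleFrom-cons (p , q , r , s , B∈B₀ , λ _ _ → refl) inF' after
    where
    Z : Mat R C
    Z = toMat X ⊖ W
    inF' : InFiber S X (W ⊖ basic p q r s)
    inF' = inFiber-move S X B∈B₀ pr<0 qs<0 inF
    norm1-after : norm1 (toMat X ⊖ (W ⊖ basic p q r s)) ≡ norm1 (Z ⊕ basic p q r s)
    norm1-after = norm1-cong (toMat X ⊖ (W ⊖ basic p q r s)) (Z ⊕ basic p q r s)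
                    (λ a b → cong ∣_∣ (entry-after-move W (basic p q r s) a b))
    reduced : 0ℤ ℤ.< Z p s ⊎ 0ℤ ℤ.< Z q r → ReducibleFrom S X (W ⊖ basic p q r s) N
    reduced positive = reducibleFrom-here (subst (_< N) (sym norm1-after)
      (ℕP.<-≤-trans (norm1-move-< Z p q r s p≢q r≢s pr<0 qs<0 positive) ≤N))
    after : ReducibleFrom S X (W ⊖ basic p q r s) N
    after with 0ℤ ℤ.<? Z p s | 0ℤ ℤ.<? Z q r
    ... | yes ps>0 | _        = reduced (inj₁ ps>0)
    ... | no _     | yes qr>0 = reduced (inj₂ qr>0)
    ... | no ps≯0  | no qr≯0  = continue inF'
      (subst (ℕ._≤ N) (sym norm1-after) (ℕP.≤-trans (norm1-move-≤ Z p q r s p≢q r≢s pr<0 qs<0) ≤N))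
      ps≯0 qr≯0

  reduce-in-row : ∀ {W N a f b} → InFiber S X W → norm1 (toMat X ⊖ W) ℕ.≤ N → ColEquiv S f b →
    (toMat X ⊖ W) a f ℤ.< 0ℤ → 0ℤ ℤ.< (toMat X ⊖ W) a b → ReducibleFrom S X W N
  reduce-in-row {W} {N} {a} {f} {b} inF ≤N f~b af<0 ab>0
    with zero-sum-has-negative (colSum-zero inF b) a ab>0
  ... | y , yb<0 =
    reduce-by-move inF ≤N
      (a≢y , f≢b , trans (basic-SSum S a y f b a≢y f≢b) (signedCorners-colEquiv S a y f~b))
      af<0 yb<0 (λ _ _ ab≯0 _ → ⊥-elim (ab≯0 ab>0))
    where
    a≢y : a ≢ y
    a≢y refl = ℤP.<-asym yb<0 ab>0
    f≢b : f ≢ b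
    f≢b refl = ℤP.<-asym af<0 ab>0

  reduce-in-block : ∀ {W N a b c f} → InFiber S X W → norm1 (toMat X ⊖ W) ℕ.≤ N →
    RowEquiv S c a → ColEquiv S f b →
    (toMat X ⊖ W) c f ℤ.< 0ℤ → 0ℤ ℤ.< (toMat X ⊖ W) a b → ReducibleFrom S X W N
  reduce-in-block {W} {N} {a} {b} {c} {f} inF ≤N c~a f~b cf<0 ab>0 with c ≟ a
  ... | yes refl = reduce-in-row inF ≤N f~b cf<0 ab>0
  ... | no c≢a with zero-sum-has-negative (rowSum-zero inF a) b ab>0
  ...   | x , ax<0 with f ≟ x
  ...     | yes refl = reduce-in-row inF ≤N f~b ax<0 ab>0
  ...     | no f≢x   =
    reduce-by-move inF ≤N
      (c≢a , f≢x , trans (basic-SSum S c a f x c≢a f≢x) (signedCorners-rowEquiv S f x c~a))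
      cf<0 ax<0 continue
    where
    continue : InFiber S X (W ⊖ basic c a f x) → norm1 (toMat X ⊖ (W ⊖ basic c a f x)) ℕ.≤ N →
      ¬ 0ℤ ℤ.< (toMat X ⊖ W) c x → ¬ 0ℤ ℤ.< (toMat X ⊖ W) a f →
      ReducibleFrom S X (W ⊖ basic c a f x) N
    continue inF' ≤N' _ af≯0 = reduce-in-row inF' ≤N' f~b af<0 ab>0'
      where
      b≢f : b ≢ f
      b≢f refl = af≯0 ab>0
      b≢x : b ≢ x
      b≢x refl = ℤP.<-asym ax<0 ab>0
      af<0 : (toMat X ⊖ (W ⊖ basic c a f x)) a f ℤ.< 0ℤ
      af<0 = entry-after-move-lowered W c a f x a f (basic-qr c a f x c≢a f≢x) af≯0
      ab>0' : 0ℤ ℤ.< (toMat X ⊖ (W ⊖ basic c a f x)) a b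
      ab>0' = subst (0ℤ ℤ.<_) (sym (entry-after-move-off W c a f x a b (off-cols b≢f b≢x))) ab>0

  reduce-rectangle : ∀ {W N a b c d e f} → InFiber S X W → norm1 (toMat X ⊖ W) ℕ.≤ N →
    RowEquiv S c a → ColEquiv S f b → ¬ RowEquiv S c e → ¬ ColEquiv S d f →
    signedCorners S c e d f ≡ 0ℤ →
    0ℤ ℤ.< (toMat X ⊖ W) a b → (toMat X ⊖ W) c d ℤ.< 0ℤ → (toMat X ⊖ W) e f ℤ.< 0ℤ →
    ReducibleFrom S X W N
  reduce-rectangle {W} {N} {a} {b} {c} {d} {e} {f} inF ≤N c~a f~b c≁e d≁f balanced ab>0 cd<0 ef<0 =
    reduce-by-move inF ≤N (c≢e , d≢f , trans (basic-SSum S c e d f c≢e d≢f) balanced) cd<0 ef<0 continue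
    where
    c≢e : c ≢ e
    c≢e refl = c≁e (λ _ → refl)
    d≢f : d ≢ f
    d≢f refl = d≁f (λ _ → refl)
    a≢e : a ≢ e
    a≢e refl = c≁e c~a
    b≢d : b ≢ d
    b≢d refl = d≁f (λ i → sym (f~b i))
    continue : InFiber S X (W ⊖ basic c e d f) → norm1 (toMat X ⊖ (W ⊖ basic c e d f)) ℕ.≤ N →
      ¬ 0ℤ ℤ.< (toMat X ⊖ W) c f → ¬ 0ℤ ℤ.< (toMat X ⊖ W) e d →
      ReducibleFrom S X (W ⊖ basic c e d f) N
    continue inF' ≤N' cf≯0 _ = reduce-in-block inF' ≤N' c~a f~b
      (entry-after-move-lowered W c e d f c f (basic-ps c e d f d≢f) cf≯0)
      (subst (0ℤ ℤ.<_) (sym (entry-after-move-off W c e d f a b ab-off)) ab>0)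
      where
      ab-off : OffRectangle c e d f a b
      ab-off with a ≟ c
      ... | yes a≡c = off-cols b≢d (λ b≡f → cf≯0 (subst₂ (λ i j → 0ℤ ℤ.< (toMat X ⊖ W) i j) a≡c b≡f ab>0))
      ... | no a≢c  = off-rows a≢c a≢e

-- Symmetries and the theorem

module _ {R C : ℕ} where

  ⊖-swap : ∀ (X Y : Table R C) a b → (toMat Y ⊖ toMat X) a b ≡ ℤ.- (toMat X ⊖ toMat Y) a b
  ⊖-swap X Y a b = flip (+ Y a b) (+ X a b)
    where
    flip : ∀ y x → y ℤ.- x ≡ ℤ.- (x ℤ.- y)
    flip = solve-∀

  ⊖-swap≡0 : ∀ (X Y : Table R C) a b →
    (toMat X ⊖ toMat Y) a b ≡ 0ℤ → (toMat Y ⊖ toMat X) a b ≡ 0ℤ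
  ⊖-swap≡0 X Y a b xy≡0 = trans (⊖-swap X Y a b) (cong ℤ.-_ xy≡0)

module _ {R C : ℕ} (S : Subset2 R C) where

  ¬rowEquiv-sym : ∀ {k k'} → ¬ RowEquiv S k k' → ¬ RowEquiv S k' k
  ¬rowEquiv-sym k≁k' k'~k = k≁k' (λ j → sym (k'~k j))

  ¬colEquiv-sym : ∀ {l l'} → ¬ ColEquiv S l l' → ¬ ColEquiv S l' l
  ¬colEquiv-sym l≁l' l'~l = l≁l' (λ i → sym (l'~l i))

  BlockNeg-swap : ∀ (X Y : Table R C) {r c} →
    BlockNeg S (toMat X ⊖ toMat Y) r c → BlockPos S (toMat Y ⊖ toMat X) r c
  BlockNeg-swap X Y ((a , b , ab∈ , ab≢0) , neg) =
    (a , b , ab∈ , ab≢0 ∘ ⊖-swap≡0 Y X a b) ,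
    λ a b ab∈ ab≢0 → subst (0ℤ ℤ.<_) (sym (⊖-swap X Y a b))
                       (ℤP.neg-mono-< (neg a b ab∈ (ab≢0 ∘ ⊖-swap≡0 X Y a b)))

  BlockPos-swap : ∀ (X Y : Table R C) {r c} →
    BlockPos S (toMat X ⊖ toMat Y) r c → BlockNeg S (toMat Y ⊖ toMat X) r c
  BlockPos-swap X Y ((a , b , ab∈ , ab≢0) , pos) =
    (a , b , ab∈ , ab≢0 ∘ ⊖-swap≡0 Y X a b) ,
    λ a b ab∈ ab≢0 → subst (ℤ._< 0ℤ) (sym (⊖-swap X Y a b))
                       (ℤP.neg-mono-< (pos a b ab∈ (ab≢0 ∘ ⊖-swap≡0 X Y a b)))

  blockCorners-balanced : ∀ {k k' l l'} →
    (∃[ i ] ∃[ i' ] ∃[ j ] ∃[ j' ]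
       (InBlock S k l i j × InBlock S k' l i' j × InBlock S k l' i j'
        × InBlock S k' l' i' j' × BasicInB0 S i i' j j')) →
    signedCorners S k k' l l' ≡ 0ℤ
  blockCorners-balanced (i , i' , j , j' , (i~k , j~l) , _ , _ , (i'~k' , j'~l') , i≢i' , j≢j' , sumB) =
    trans (sym (signedCorners-cong S i~k i'~k' j~l j'~l'))
          (trans (sym (basic-SSum S i i' j j' i≢i' j≢j')) sumB)

  blocks-reduce : ∀ {X Y : Table R C} {k k' l l'} → SameFiber S X Y →
    ¬ RowEquiv S k k' → ¬ ColEquiv S l l' →
    BlockPos S (toMat X ⊖ toMat Y) k l → BlockNeg S (toMat X ⊖ toMat Y) k l' →
    BlockNeg S (toMat X ⊖ toMat Y) k' l → signedCorners S k k' l l' ≡ 0ℤ →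
    ReducibleFrom S X (toMat Y) (norm1 (toMat X ⊖ toMat Y))
  blocks-reduce {X} {Y} {k} {k'} {l} {l'} X~Y k≁k' l≁l'
    ((a , b , ab∈kl@(a~k , b~l) , ab≢0) , pos) ((c , d , cd∈kl'@(c~k , d~l') , cd≢0) , neg)
    ((e , f , ef∈k'l@(e~k' , f~l) , ef≢0) , neg') balanced =
    reduce-rectangle S X (Y , sameFiber-sym X~Y , λ _ _ → refl) ℕP.≤-refl
      (λ j → trans (c~k j) (sym (a~k j))) (λ i → trans (f~l i) (sym (b~l i)))
      (λ c~e → k≁k' (λ j → trans (sym (c~k j)) (trans (c~e j) (e~k' j))))
      (λ d~f → l≁l' (λ i → trans (sym (f~l i)) (trans (sym (d~f i)) (d~l' i))))
      (trans (signedCorners-cong S c~k e~k' d~l' f~l)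
             (trans (signedCorners-swapCols S k k' l l') (cong ℤ.-_ balanced)))
      (pos a b ab∈kl ab≢0) (neg c d cd∈kl' cd≢0) (neg' e f ef∈k'l ef≢0)

  moves-nonempty : ∀ (Z : Mat R C) Bs → norm1 (Z ⊕ sumM Bs) < norm1 Z → 0 < length Bs
  moves-nonempty Z []      lt = ⊥-elim (ℕP.<-irrefl (norm1-⊕-[] Z) lt)
  moves-nonempty Z (_ ∷ _) _  = ℕ.s≤s ℕ.z≤n

  reducible-minus : ∀ {X Y : Table R C} →
    ReducibleFrom S X (toMat Y) (norm1 (toMat X ⊖ toMat Y)) → Reducible S X Y
  reducible-minus {X} {Y} (Bs , Bs∈B₀ , valid , lt) =
    [] , Bs , moves-nonempty Z Bs lt , [] , Bs∈B₀ , tt , valid ,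
    subst (_< norm1 Z) (norm1-cong (Z ⊕ sumM Bs) ((Z ⊕ sumM []) ⊕ sumM Bs)
      (λ a b → cong (λ t → ∣ t ℤ.+ sumM Bs a b ∣) (sym (ℤP.+-identityʳ (Z a b))))) lt
    where
    Z : Mat R C
    Z = toMat X ⊖ toMat Y

  negM : Mat R C → Mat R C
  negM B a b = ℤ.- B a b

  IsB0-negM : ∀ {B} → IsB0 S B → IsB0 S (negM B)
  IsB0-negM (p , q , r , s , (p≢q , r≢s , sumB) , B≡) =
    q , p , r , s , (p≢q ∘ sym , r≢s , sum-swapped) ,
    λ a b → trans (cong ℤ.-_ (B≡ a b)) (basic-swapRows p q r s p≢q r≢s a b)
    where
    sum-swapped : SSumℤ S (basic q p r s) ≡ 0ℤ
    sum-swapped = trans (basic-SSum S q p r s (p≢q ∘ sym) r≢s)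
      (trans (signedCorners-swapRows S p q r s)
             (cong ℤ.-_ (trans (sym (basic-SSum S p q r s p≢q r≢s)) sumB)))

  sumM-negM : ∀ Bs a b → sumM (map negM Bs) a b ≡ ℤ.- sumM Bs a b
  sumM-negM []       a b = refl
  sumM-negM (B ∷ Bs) a b =
    trans (cong (ℤ._+_ (ℤ.- B a b)) (sumM-negM Bs a b)) (sym (ℤP.neg-distrib-+ (B a b) (sumM Bs a b)))

  -- W ⊖ B and W ⊕ negM B are definitionally equal, since i - j = i + - j.
  validMinus⇒validPlus : ∀ {X Y : Table R C} → SameFiber S X Y →
    ∀ W Bs → ValidMinus S Y W Bs → ValidPlus S X W (map negM Bs)
  validMinus⇒validPlus X~Y W []       _ = tt
  validMinus⇒validPlus X~Y W (B ∷ Bs) ((T , T~Y , T≡) , valid) =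
    (T , sameFiber-trans T~Y (sameFiber-sym X~Y) , T≡) , validMinus⇒validPlus X~Y (W ⊖ B) Bs valid

  reducible-plus : ∀ {X Y : Table R C} → SameFiber S X Y →
    ReducibleFrom S Y (toMat X) (norm1 (toMat Y ⊖ toMat X)) → Reducible S X Y
  reducible-plus {X} {Y} X~Y (Bs , Bs∈B₀ , valid , lt) =
    map negM Bs , [] , nonempty , negated Bs∈B₀ , [] ,
    validMinus⇒validPlus X~Y (toMat X) Bs valid , tt ,
    subst₂ _<_ (sym (norm1-neg _ ((toMat Y ⊖ toMat X) ⊕ sumM Bs) negated-difference))
               (norm1-neg (toMat Y ⊖ toMat X) (toMat X ⊖ toMat Y) (⊖-swap X Y)) lt
    where
    nonempty : 0 < length (map negM Bs) ℕ.+ 0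
    nonempty = subst (0 <_) (sym (trans (ℕP.+-identityʳ _) (length-map negM Bs)))
      (moves-nonempty (toMat Y ⊖ toMat X) Bs lt)
    negated : ∀ {Bs} → All (IsB0 S) Bs → All (IsB0 S) (map negM Bs)
    negated []             = []
    negated (B∈B₀ ∷ Bs∈B₀) = IsB0-negM B∈B₀ ∷ negated Bs∈B₀
    regroup : ∀ x y t → ((x ℤ.- y) ℤ.+ ℤ.- t) ℤ.+ 0ℤ ≡ ℤ.- ((y ℤ.- x) ℤ.+ t)
    regroup = solve-∀
    negated-difference : ∀ a b → (((toMat X ⊖ toMat Y) ⊕ sumM (map negM Bs)) ⊕ sumM []) a b ≡
      ℤ.- ((toMat Y ⊖ toMat X) ⊕ sumM Bs) a b
    negated-difference a b =
      trans (cong (λ t → ((+ X a b ℤ.- + Y a b) ℤ.+ t) ℤ.+ 0ℤ) (sumM-negM Bs a b))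
            (regroup (+ X a b) (+ Y a b) (sumM Bs a b))

lemma3 : (R C : ℕ) → 0 < R → 0 < C →
    (S : Subset2 R C) → Nonempty S → Proper S → Triangular S →
    (X Y : Table R C) → SameFiber S X Y → ¬ (∀ i j → X i j ≡ Y i j) →
    (k k' : Fin R) → (l l' : Fin C) →
    ¬ RowEquiv S k k' → ¬ ColEquiv S l l' →
    ((BlockPos S (toMat X ⊖ toMat Y) k l × BlockNeg S (toMat X ⊖ toMat Y) k l'
        × BlockNeg S (toMat X ⊖ toMat Y) k' l)
     ⊎ (BlockNeg S (toMat X ⊖ toMat Y) k l' × BlockNeg S (toMat X ⊖ toMat Y) k' l
        × BlockPos S (toMat X ⊖ toMat Y) k' l')
     ⊎ (BlockNeg S (toMat X ⊖ toMat Y) k l × BlockPos S (toMat X ⊖ toMat Y) k l'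
        × BlockPos S (toMat X ⊖ toMat Y) k' l)
     ⊎ (BlockPos S (toMat X ⊖ toMat Y) k l' × BlockPos S (toMat X ⊖ toMat Y) k' l
        × BlockNeg S (toMat X ⊖ toMat Y) k' l')) →
    (∃[ i ] ∃[ i' ] ∃[ j ] ∃[ j' ]
       (InBlock S k l i j × InBlock S k' l i' j × InBlock S k l' i j'
        × InBlock S k' l' i' j' × BasicInB0 S i i' j j')) →
    Reducible S X Y
lemma3 _ _ _ _ S _ _ _ X Y X~Y _ k k' l l' k≁k' l≁l' (inj₁ (pos , neg , neg')) move =
  reducible-minus S (blocks-reduce S X~Y k≁k' l≁l' pos neg neg' (blockCorners-balanced S move))
lemma3 _ _ _ _ S _ _ _ X Y X~Y _ k k' l l' k≁k' l≁l' (inj₂ (inj₁ (neg , neg' , pos))) move =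
  reducible-minus S
    (blocks-reduce S X~Y (¬rowEquiv-sym S k≁k') (¬colEquiv-sym S l≁l') pos neg' neg
      (trans (signedCorners-swapBoth S k k' l l') (blockCorners-balanced S move)))
lemma3 _ _ _ _ S _ _ _ X Y X~Y _ k k' l l' k≁k' l≁l' (inj₂ (inj₂ (inj₁ (neg , pos , pos')))) move =
  reducible-plus S X~Y
    (blocks-reduce S (sameFiber-sym X~Y) k≁k' l≁l'
      (BlockNeg-swap S X Y neg) (BlockPos-swap S X Y pos) (BlockPos-swap S X Y pos')
      (blockCorners-balanced S move))
lemma3 _ _ _ _ S _ _ _ X Y X~Y _ k k' l l' k≁k' l≁l' (inj₂ (inj₂ (inj₂ (pos , pos' , neg)))) move =
  reducible-plus S X~Y
    (blocks-reduce S (sameFiber-sym X~Y) (¬rowEquiv-sym S k≁k') (¬colEquiv-sym S l≁l')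
      (BlockNeg-swap S X Y neg) (BlockPos-swap S X Y pos') (BlockPos-swap S X Y pos)
      (trans (signedCorners-swapBoth S k k' l l') (blockCorners-balanced S move)))
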